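{- Let $\mathsf{K}$ be a variety, $\mathbf{B}\in\mathsf{K}$, and $\mathbf{A}\le\mathbf{B}$ full in $\mathsf{K}$. If $\phi$ is a congruence of $\mathbf{A}$ and there exists a congruence $\theta$ of $\mathbf{B}$ with $\theta\ne\mathrm{id}_B$ and $\theta\cap(A\times A)\subseteq\phi$, then $\phi=\mathrm{Cg}^{\mathbf{B}}(\phi)\cap(A\times A)$.
   Context: A variety is a class of similar algebras closed under homomorphic images, subalgebras and direct products. For $X\subseteq B\times B$, $\mathrm{Cg}^{\mathbf{B}}(X)$ is the least congruence of $\mathbf{B}$ containing $X$; $\mathrm{id}_B$ is the identity relation. A subalgebra $\mathbf{A}\le\mathbf{B}$ is full in $\mathsf{K}$ if it is proper, $B$ is generated by $A\cup\{b\}$ for some $b\in B$, and every congruence $\theta\ne\mathrm{id}_B$ of $\mathbf{B}$ relates every $b\in B$ to some element of $A$. -}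

module Defs where

open import Data.Nat using (ℕ)
open import Data.Fin using (Fin)
open import Data.Sum using (_⊎_)
open import Data.Product using (Σ; ∃; _×_; _,_; proj₁; proj₂)
open import Relation.Nullary using (¬_)
open import Relation.Binary.PropositionalEquality using (_≡_)
open import Function using (_∘_; Injective; Surjective)
open import Level using (Level; suc; zero)

record Signature : Set₁ where
  field
    Op    : Set
    arity : Op → ℕ
open Signature public

record Algebra (S : Signature) : Set₁ where
  field
    Carrier : Set
    op      : (f : Op S) → (Fin (arity S f) → Carrier) → Carrier
open Algebra public

module _ {S : Signature} where

  IsHom : (A B : Algebra S) → (Carrier A → Carrier B) → Set
  IsHom A B h = ∀ (f : Op S) (xs : Fin (arity S f) → Carrier A) →
                h (op A f xs) ≡ op B f (h ∘ xs)

  record IsCongruence (A : Algebra S) (θ : Carrier A → Carrier A → Set) : Set where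
    field
      refl′  : ∀ x → θ x x
      sym′   : ∀ {x y} → θ x y → θ y x
      trans′ : ∀ {x y z} → θ x y → θ y z → θ x z
      compat : ∀ (f : Op S) (xs ys : Fin (arity S f) → Carrier A) →
               (∀ i → θ (xs i) (ys i)) → θ (op A f xs) (op A f ys)

  NotIdentity : (A : Algebra S) → (Carrier A → Carrier A → Set) → Set
  NotIdentity A θ = ¬ (∀ x y → (θ x y → x ≡ y) × (x ≡ y → θ x y))

  IsSubuniverse : (B : Algebra S) → (Carrier B → Set) → Set
  IsSubuniverse B P = ∀ (f : Op S) (xs : Fin (arity S f) → Carrier B) →
                      (∀ i → P (xs i)) → P (op B f xs)

  SubAlg : (B : Algebra S) (P : Carrier B → Set) → IsSubuniverse B P → Algebra S
  SubAlg B P cl = record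
    { Carrier = Σ (Carrier B) P
    ; op = λ f xs → op B f (proj₁ ∘ xs) , cl f (proj₁ ∘ xs) (proj₂ ∘ xs) }

  Sg : (B : Algebra S) → (Carrier B → Set) → Carrier B → Set₁
  Sg B X x = ∀ (P : Carrier B → Set) → IsSubuniverse B P → (∀ y → X y → P y) → P x

  Cg : (B : Algebra S) → (Carrier B → Carrier B → Set) → Carrier B → Carrier B → Set₁
  Cg B X x y = ∀ (θ : Carrier B → Carrier B → Set) → IsCongruence B θ →
               (∀ u v → X u v → θ u v) → θ x y

  -- A (universe P, a subuniverse of B) is full: proper, B = Sg(A ∪ {b}) for
  -- some b, and every congruence θ ≠ id_B relates each element of B to some
  -- element of A.  (Membership B ∈ K is a separate hypothesis.)
  record IsFull (B : Algebra S) (P : Carrier B → Set) : Set₁ where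
    field
      proper    : ∃ λ b → ¬ P b
      generated : ∃ λ b → ∀ x → Sg B (λ y → P y ⊎ (y ≡ b)) x
      absorbing : ∀ (θ : Carrier B → Carrier B → Set) → IsCongruence B θ →
                  NotIdentity B θ → ∀ x → ∃ λ a → P a × θ x a

  Prod : (I : Set) → (I → Algebra S) → Algebra S
  Prod I 𝒜 = record
    { Carrier = ∀ i → Carrier (𝒜 i)
    ; op = λ f xs i → op (𝒜 i) f (λ k → xs k i) }

  record IsVariety (K : Algebra S → Set₁) : Set₁ where
    field
      closedH : ∀ A C (h : Carrier A → Carrier C) → K A → IsHom A C h →
                Surjective _≡_ _≡_ h → K C
      closedS : ∀ A C (h : Carrier C → Carrier A) → K A → IsHom C A h →
                Injective _≡_ _≡_ h → K C
      closedP : ∀ (I : Set) (𝒜 : I → Algebra S) → (∀ i → K (𝒜 i)) → K (Prod I 𝒜)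

{-# OPTIONS --safe #-}
module Submission where

-- Let θ be a congruence of B with θ ≠ id_B and θ ∩ A² ⊆ φ.  By fullness θ links
-- every element of B to A, so the relation θ ∘ φ ∘ θ (with its φ-step taken
-- inside A) is reflexive, and it is then a congruence of B containing φ.
-- Its trace on A is φ, because the two θ-steps between elements of A already
-- lie in φ.  Hence Cg^B(φ) ∩ A² ⊆ θ ∘ φ ∘ θ ∩ A² = φ.

open import Defs
open import Data.Fin using (Fin)
open import Function using (_∘_)
open import Data.Product using (Σ; ∃; _×_; _,_; proj₁)
open import Relation.Binary.PropositionalEquality using (_≡_; refl)

module _ {S : Signature} (B : Algebra S) {P : Carrier B → Set} (cl : IsSubuniverse B P) where

  private
    U : Set
    U = Carrier B

    A : Set
    A = Σ U P

  LiftRel : (A → A → Set) → U → U → Set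
  LiftRel φ u v = ∃ λ (a : A) → ∃ λ (c : A) → φ a c × (u ≡ proj₁ a) × (v ≡ proj₁ c)

  record Sandwich (θ : U → U → Set) (φ : A → A → Set) (u v : U) : Set where
    constructor sandwich
    field
      {left right} : A
      θ-left  : θ u (proj₁ left)
      φ-mid   : φ left right
      θ-right : θ (proj₁ right) v

  RestrictsInto : (U → U → Set) → (A → A → Set) → Set
  RestrictsInto θ φ = ∀ (x y : A) → θ (proj₁ x) (proj₁ y) → φ x y

  Absorbing : (U → U → Set) → Set
  Absorbing θ = ∀ u → ∃ λ a → P a × θ u a

  liftRel⊆sandwich : ∀ {θ φ} → IsCongruence B θ → ∀ {u v} → LiftRel φ u v → Sandwich θ φ u v
  liftRel⊆sandwich θC (_ , _ , p , refl , refl) = sandwich (refl′ _) p (refl′ _)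
    where open IsCongruence θC

  module _ {θ : U → U → Set} {φ : A → A → Set}
           (θC : IsCongruence B θ) (φC : IsCongruence (SubAlg B P cl) φ)
           (θ⊆φ : RestrictsInto θ φ) where

    private
      module θ = IsCongruence θC
      module φ = IsCongruence φC

    sandwich-restrictsInto : RestrictsInto (Sandwich θ φ) φ
    sandwich-restrictsInto x y (sandwich xθa aφc cθy) =
      φ.trans′ (θ⊆φ x _ xθa) (φ.trans′ aφc (θ⊆φ _ y cθy))

    sandwich-isCongruence : Absorbing θ → IsCongruence B (Sandwich θ φ)
    sandwich-isCongruence absorbing = record
      { refl′  = refl′
      ; sym′   = λ { (sandwich uθa aφc cθv) → sandwich (θ.sym′ cθv) (φ.sym′ aφc) (θ.sym′ uθa) }
      ; trans′ = trans′
      ; compat = compat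
      }
      where
      open Sandwich

      refl′ : ∀ u → Sandwich θ φ u u
      refl′ u with absorbing u
      ... | a , pa , uθa = sandwich {left = a , pa} uθa (φ.refl′ _) (θ.sym′ uθa)

      trans′ : ∀ {u v w} → Sandwich θ φ u v → Sandwich θ φ v w → Sandwich θ φ u w
      trans′ (sandwich uθa aφc cθv) (sandwich vθa′ a′φc′ c′θw) =
        sandwich uθa (φ.trans′ aφc (φ.trans′ (θ⊆φ _ _ (θ.trans′ cθv vθa′)) a′φc′)) c′θw

      compat : ∀ f (us vs : Fin (arity S f) → U) → (∀ i → Sandwich θ φ (us i) (vs i)) →
               Sandwich θ φ (op B f us) (op B f vs)
      compat f us vs sandwiches =
        sandwich {left  = op (SubAlg B P cl) f (left ∘ sandwiches)}
                 {right = op (SubAlg B P cl) f (right ∘ sandwiches)}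
                 (θ.compat f _ _ (θ-left ∘ sandwiches))
                 (φ.compat f _ _ (φ-mid ∘ sandwiches))
                 (θ.compat f _ _ (θ-right ∘ sandwiches))

lemma5p6 : (S : Signature) (K : Algebra S → Set₁) → IsVariety K →
    (B : Algebra S) → K B →
    (P : Carrier B → Set) (cl : IsSubuniverse B P) → IsFull B P →
    (φ : Σ (Carrier B) P → Σ (Carrier B) P → Set) → IsCongruence (SubAlg B P cl) φ →
    (∃ λ (θ : Carrier B → Carrier B → Set) → IsCongruence B θ × NotIdentity B θ ×
       (∀ (x y : Σ (Carrier B) P) → θ (proj₁ x) (proj₁ y) → φ x y)) →
    ∀ (x y : Σ (Carrier B) P) →
      (φ x y →
         Cg B (λ u v → ∃ λ (a : Σ (Carrier B) P) → ∃ λ (c : Σ (Carrier B) P) →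
                 φ a c × (u ≡ proj₁ a) × (v ≡ proj₁ c)) (proj₁ x) (proj₁ y))
      × (Cg B (λ u v → ∃ λ (a : Σ (Carrier B) P) → ∃ λ (c : Σ (Carrier B) P) →
                 φ a c × (u ≡ proj₁ a) × (v ≡ proj₁ c)) (proj₁ x) (proj₁ y) →
         φ x y)
lemma5p6 _ _ _ B _ P cl full φ φC (θ , θC , θ≢id , θ⊆φ) x y = φ⊆Cg , Cg⊆φ
  where
  sandwichC : IsCongruence B (Sandwich B cl θ φ)
  sandwichC = sandwich-isCongruence B cl θC φC θ⊆φ (IsFull.absorbing full θ θC θ≢id)

  φ⊆Cg : φ x y → Cg B (LiftRel B cl φ) (proj₁ x) (proj₁ y)
  φ⊆Cg xφy _ _ φ⊆ψ = φ⊆ψ _ _ (x , y , xφy , refl , refl)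

  Cg⊆φ : Cg B (LiftRel B cl φ) (proj₁ x) (proj₁ y) → φ x y
  Cg⊆φ xCgy = sandwich-restrictsInto B cl θC φC θ⊆φ x y
                (xCgy _ sandwichC (λ _ _ → liftRel⊆sandwich B cl θC))
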